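{- Let $G$ be a graph that contains no induced $C_5$, no induced bull, and no anchor. Then $G$ is pure. In fact, every shortest odd hole in $G$ is clean.
   Context: All graphs are finite and simple. A hole is an induced subgraph isomorphic to a cycle $C_k$ with $k\ge4$; it is odd if $k$ is odd; a shortest odd hole is an odd hole of minimum length. The bull is the graph consisting of a triangle together with two disjoint pendant edges. A path $p_1-\dots-p_k$ is a sequence of distinct vertices with $p_i$ adjacent to $p_j$ iff $|i-j|=1$. A six-vertex graph is an anchor if it consists of a 4-vertex induced path $P$, a vertex $c$ adjacent to all vertices of $P$, and a vertex $a$ adjacent to no vertex of $P$ (the pair $a,c$ may be adjacent or not). A hole $C$ in $G$ is clean if for every $v\in V(G)\setminus V(C)$, the set of neighbors of $v$ in $V(C)$ is contained in the vertex set of some path of $C$ with two edges. $G$ is pure if either $G$ contains no odd hole, or $G$ contains a shortest odd hole that is clean. -}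

module Defs where

open import Data.Nat using (ℕ; zero; suc; _+_; _*_; _≤_; _≟_)
open import Data.Fin using (Fin; toℕ)
open import Data.Bool using (Bool; true; false; _∨_; _∧_)
open import Data.List using (List; []; _∷_)
open import Data.Product using (Σ; ∃; ∃-syntax; _×_; _,_)
open import Data.Sum using (_⊎_)
open import Relation.Nullary using (¬_; does)
open import Relation.Binary.PropositionalEquality using (_≡_; _≢_)
open import Function.Definitions using (Injective)
open import Function.Bundles using (_⇔_)

record Graph : Set where
  field
    n      : ℕ
    E      : Fin n → Fin n → Bool
    sym    : ∀ i j → E i j ≡ E j i
    irrefl : ∀ i → E i i ≡ false

open Graph public

Vertex : Graph → Set
Vertex G = Fin (n G)

Adj : (G : Graph) → Vertex G → Vertex G → Set
Adj G u v = E G u v ≡ true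

InducedIn : {m : ℕ} → (Fin m → Fin m → Bool) → Graph → Set
InducedIn {m} H G =
  Σ (Fin m → Vertex G) λ f →
    Injective _≡_ _≡_ f × (∀ i j → E G (f i) (f j) ≡ H i j)

edgeB : List (ℕ × ℕ) → ℕ → ℕ → Bool
edgeB [] a b = false
edgeB ((x , y) ∷ es) a b =
  ((does (a ≟ x) ∧ does (b ≟ y)) ∨ (does (a ≟ y) ∧ does (b ≟ x))) ∨ edgeB es a b

fromEdges : (m : ℕ) → List (ℕ × ℕ) → Fin m → Fin m → Bool
fromEdges m es i j = edgeB es (toℕ i) (toℕ j)

C5-E : Fin 5 → Fin 5 → Bool
C5-E = fromEdges 5 ((0 , 1) ∷ (1 , 2) ∷ (2 , 3) ∷ (3 , 4) ∷ (4 , 0) ∷ [])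

Bull-E : Fin 5 → Fin 5 → Bool
Bull-E = fromEdges 5 ((0 , 1) ∷ (1 , 2) ∷ (0 , 2) ∷ (0 , 3) ∷ (1 , 4) ∷ [])

-- Anchors: induced path P = 0-1-2-3, vertex c = 4 adjacent to all of P,
-- vertex a = 5 adjacent to no vertex of P; a,c adjacent or not.
Anchor1-E : Fin 6 → Fin 6 → Bool
Anchor1-E = fromEdges 6 ((0 , 1) ∷ (1 , 2) ∷ (2 , 3) ∷
                         (4 , 0) ∷ (4 , 1) ∷ (4 , 2) ∷ (4 , 3) ∷ [])

Anchor2-E : Fin 6 → Fin 6 → Bool
Anchor2-E = fromEdges 6 ((0 , 1) ∷ (1 , 2) ∷ (2 , 3) ∷
                         (4 , 0) ∷ (4 , 1) ∷ (4 , 2) ∷ (4 , 3) ∷ (4 , 5) ∷ [])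

CycAdj : (k : ℕ) → Fin k → Fin k → Set
CycAdj k i j =
  (suc (toℕ i) ≡ toℕ j) ⊎ (suc (toℕ j) ≡ toℕ i) ⊎
  (toℕ i ≡ 0 × suc (toℕ j) ≡ k) ⊎ (toℕ j ≡ 0 × suc (toℕ i) ≡ k)

record Hole (G : Graph) : Set where
  field
    len    : ℕ
    len≥4  : 4 ≤ len
    v      : Fin len → Vertex G
    v-inj  : Injective _≡_ _≡_ v
    v-adj  : ∀ i j → Adj G (v i) (v j) ⇔ CycAdj len i j

open Hole public

Odd : ℕ → Set
Odd k = ∃[ m ] k ≡ suc (2 * m)

OddHole : Graph → Set
OddHole G = Σ (Hole G) λ C → Odd (len C)

ShortestOddHole : (G : Graph) → Hole G → Set
ShortestOddHole G C = Odd (len C) × (∀ (D : Hole G) → Odd (len D) → len C ≤ len D)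

-- A hole C is clean if every vertex outside V(C) has its neighbours in V(C)
-- contained in the vertex set of some two-edge path of C, i.e. in
-- {v (i-1), v i, v (i+1)} for some position i.
Clean : (G : Graph) → Hole G → Set
Clean G C =
  ∀ (u : Vertex G) → (∀ i → u ≢ v C i) →
    ∃[ i ] (∀ j → Adj G u (v C j) → (j ≡ i) ⊎ CycAdj (len C) i j)

Pure : Graph → Set
Pure G = (¬ OddHole G) ⊎ (Σ (Hole G) λ C → ShortestOddHole G C × Clean G C)

module Submission where

-- Let C be a shortest odd hole, of length K, and u a vertex off C. Since G has no C5, K ≥ 7, so any
-- six consecutive vertices of C induce a path. If u has two consecutive neighbours on C, look at the
-- maximal run of consecutive neighbours containing them: a run of two gives a bull, a run of four an
-- anchor, and next to a run of three any further neighbour of u gives a bull, so N(u) ∩ C is that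
-- run. Otherwise two cyclically consecutive neighbours of u at distance L along C close, with u, a
-- hole of length L + 2. If L + 2 < K this hole is shorter than C, so L is even; if L + 2 ≥ K the
-- remaining neighbours of u lie on a two-edge path of C. As K is odd, not every gap is even.
-- Purity then follows because a shortest odd hole, if there is one, can be found by exhaustive search.

open import Defs hiding (sym)
open import Data.Bool using (Bool; true; false)
import Data.Bool.Properties as Bool
open import Data.Empty using (⊥; ⊥-elim)
open import Data.Fin as Fin using (Fin; toℕ; fromℕ<)
open import Data.Fin.Properties using (toℕ-injective; toℕ-fromℕ<; toℕ<n; any?; all?; injective⇒≤)
  renaming (_≟_ to _≟ᶠ_)
open import Data.Nat
open import Data.Nat.DivMod
open import Data.Nat.Properties
open import Data.Nat.Tactic.RingSolver using (solve-∀)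
open import Data.Product
open import Data.Sum
open import Data.Unit using (⊤)
open import Data.Vec using (Vec; []; _∷_; lookup)
open import Function using (_∘_; case_of_; id)
open import Function.Bundles using (_⇔_; Equivalence; mk⇔)
open import Function.Definitions using (Injective)
import Function.Properties.Equivalence as ⇔
open import Relation.Binary.Definitions using (tri<; tri≈; tri>)
open import Relation.Binary.PropositionalEquality
open import Relation.Nullary
open import Relation.Nullary.Decidable
  using (True; toWitness; from-yes; map′; does-⇔; T?; _×-dec_; _⊎-dec_; _→-dec_)

Even : ℕ → Set
Even k = ∃[ m ] k ≡ 2 * m

even⊎odd : ∀ k → Even k ⊎ Odd k
even⊎odd zero = inj₁ (0 , refl)
even⊎odd (suc k) with even⊎odd k
... | inj₁ (m , refl) = inj₂ (m , refl)
... | inj₂ (m , refl) = inj₁ (suc m , lemma m)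
  where
  lemma : ∀ m → 2 + 2 * m ≡ 2 * suc m
  lemma = solve-∀

even⇒¬odd : ∀ {k} → Even k → ¬ Odd k
even⇒¬odd {k} (m , k≡2m) (m′ , k≡1+2m′) = 0≢1+n (trans (sym k%2≡0) k%2≡1)
  where
  k%2≡0 : k % 2 ≡ 0
  k%2≡0 = trans (cong (_% 2) (trans k≡2m (*-comm 2 m))) (m*n%n≡0 m 2)
  k%2≡1 : k % 2 ≡ 1
  k%2≡1 = trans (cong (_% 2) (trans k≡1+2m′ (cong suc (*-comm 2 m′)))) ([m+kn]%n≡m%n 1 m′ 2)

odd? : ∀ k → Dec (Odd k)
odd? k with even⊎odd k
... | inj₁ even = no (even⇒¬odd even)
... | inj₂ odd  = yes odd

even-+ : ∀ {a b} → Even a → Even b → Even (a + b)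
even-+ (m , refl) (m′ , refl) = m + m′ , sym (*-distribˡ-+ 2 m m′)

odd-2+ : ∀ {a} → Odd a → Odd (2 + a)
odd-2+ (m , refl) = suc m , lemma m
  where
  lemma : ∀ m → 3 + 2 * m ≡ suc (2 * suc m)
  lemma = solve-∀

module _ {K : ℕ} .{{_ : NonZero K}} where

  %-shift-injective : ∀ y {d} → d < K → (d + y) % K ≡ y % K → d ≡ 0
  %-shift-injective y {d} d<K eq = below-K q (+-cancelˡ-≡ r d (q * K) decomposition)
    where
    open ≡-Reasoning
    r = y % K
    q = (d + r) / K
    decomposition : r + d ≡ r + q * K
    decomposition = begin
      r + d                    ≡⟨ +-comm r d ⟩
      d + r                    ≡⟨ m≡m%n+[m/n]*n (d + r) K ⟩
      (d + r) % K + q * K      ≡⟨ cong (_+ q * K) (begin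
        (d + r) % K            ≡⟨ cong (λ e → (e + r) % K) (m<n⇒m%n≡m d<K) ⟨
        (d % K + r) % K        ≡⟨ %-distribˡ-+ d y K ⟨
        (d + y) % K            ≡⟨ eq ⟩
        r                      ∎) ⟩
      r + q * K                ∎
    below-K : ∀ q → d ≡ q * K → d ≡ 0
    below-K zero    d≡0    = d≡0
    below-K (suc q) d≡K+qK = ⊥-elim (<⇒≱ d<K (subst (K ≤_) (sym d≡K+qK) (m≤m+n K (q * K))))

  %-offsets-distinct : ∀ x {a b} → a < b → b < K → (b + x) % K ≢ (a + x) % K
  %-offsets-distinct x {a} a<b b<K eq with m≤n⇒∃[o]m+o≡n a<b
  ... | k , refl = case %-shift-injective (a + x) 1+k<K (trans (cong (_% K) (sym (shift a k x))) eq) of λ ()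
    where
    1+k<K : suc k < K
    1+k<K = ≤-trans (s≤s (s≤s (m≤n+m k a))) b<K
    shift : ∀ a k x → (suc a + k) + x ≡ suc k + (a + x)
    shift = solve-∀

  %-window-injective : ∀ x {a b} → a < K → b < K → (a + x) % K ≡ (b + x) % K → a ≡ b
  %-window-injective x {a} {b} a<K b<K eq with <-cmp a b
  ... | tri≈ _ a≡b _ = a≡b
  ... | tri< a<b _ _ = ⊥-elim (%-offsets-distinct x a<b b<K (sym eq))
  ... | tri> _ _ b<a = ⊥-elim (%-offsets-distinct x b<a a<K eq)

cycAdj? : ∀ k (i j : Fin k) → Dec (CycAdj k i j)
cycAdj? k i j = (suc (toℕ i) ≟ toℕ j) ⊎-dec (suc (toℕ j) ≟ toℕ i) ⊎-dec
                ((toℕ i ≟ 0) ×-dec (suc (toℕ j) ≟ k)) ⊎-dec ((toℕ j ≟ 0) ×-dec (suc (toℕ i) ≟ k))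

cycAdj-sym : ∀ {k} {i j : Fin k} → CycAdj k i j → CycAdj k j i
cycAdj-sym (inj₁ e)               = inj₂ (inj₁ e)
cycAdj-sym (inj₂ (inj₁ e))        = inj₁ e
cycAdj-sym (inj₂ (inj₂ (inj₁ e))) = inj₂ (inj₂ (inj₂ e))
cycAdj-sym (inj₂ (inj₂ (inj₂ e))) = inj₂ (inj₂ (inj₁ e))

PathAdj : ∀ {k} → Fin k → Fin k → Set
PathAdj i j = suc (toℕ i) ≡ toℕ j ⊎ suc (toℕ j) ≡ toℕ i

-- Induced subgraphs from adjacency tables

Pattern : ℕ → Set
Pattern m = Fin m → Fin m → Bool

TwinFree : ∀ {m} → Pattern m → Set
TwinFree H = ∀ i j → (∀ l → H i l ≡ H j l) → i ≡ j

twinFree? : ∀ {m} (H : Pattern m) → Dec (TwinFree H)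
twinFree? H = all? λ i → all? λ j → all? (λ l → H i l Bool.≟ H j l) →-dec (i ≟ᶠ j)

SimpleGraph : ∀ {m} → Pattern m → Set
SimpleGraph H = ∀ i j → H i j ≡ H j i × H i i ≡ false

simpleGraph? : ∀ {m} (H : Pattern m) → Dec (SimpleGraph H)
simpleGraph? H = all? λ i → all? λ j → (H i j Bool.≟ H j i) ×-dec (H i i Bool.≟ false)

Cycle-E : (k : ℕ) → Pattern k
Cycle-E k i j = does (cycAdj? k i j)

module Patterns (G : Graph) where

  adj-irrefl : ∀ {x} → ¬ Adj G x x
  adj-irrefl {x} x~x = case trans (sym x~x) (irrefl G x) of λ ()

  E-sym : ∀ {x y b} → E G x y ≡ b → E G y x ≡ b
  E-sym {x} {y} = trans (Graph.sym G y x)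

  Realises : ∀ {m} → Pattern m → (Fin m → Vertex G) → Set
  Realises H f = ∀ i j → E G (f i) (f j) ≡ H i j

  realises⇒induced : ∀ {m} {H : Pattern m} {f} → TwinFree H → Realises H f → InducedIn H G
  realises⇒induced {f = f} twin-free realises =
    f , (λ {i} {j} fi≡fj → twin-free i j λ l →
           trans (sym (realises i l)) (trans (cong (λ x → E G x (f l)) fi≡fj) (realises j l))) ,
    realises

  RowFrom : ∀ {k} → Vertex G → Vec (Vertex G) k → (Fin k → Bool) → Set
  RowFrom x []       h = ⊤
  RowFrom x (y ∷ ys) h = E G x y ≡ h Fin.zero × RowFrom x ys (h ∘ Fin.suc)

  UpperTriangle : ∀ {m} → Vec (Vertex G) m → Pattern m → Set
  UpperTriangle []       H = ⊤
  UpperTriangle (x ∷ xs) H =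
    RowFrom x xs (H Fin.zero ∘ Fin.suc) × UpperTriangle xs (λ i j → H (Fin.suc i) (Fin.suc j))

  lookup-row : ∀ {k x} {ys : Vec (Vertex G) k} {h} → RowFrom x ys h → ∀ j → E G x (lookup ys j) ≡ h j
  lookup-row {ys = y ∷ ys} (xy , _)   Fin.zero    = xy
  lookup-row {ys = y ∷ ys} (_ , row)  (Fin.suc j) = lookup-row row j

  upper⇒realises : ∀ {m} {H : Pattern m} (xs : Vec (Vertex G) m) →
                   SimpleGraph H → UpperTriangle xs H → Realises H (lookup xs)
  upper⇒realises (x ∷ xs) simple (row , _) Fin.zero Fin.zero =
    trans (irrefl G x) (sym (proj₂ (simple Fin.zero Fin.zero)))
  upper⇒realises (x ∷ xs) simple (row , _) Fin.zero (Fin.suc j) = lookup-row row j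
  upper⇒realises (x ∷ xs) simple (row , _) (Fin.suc i) Fin.zero =
    E-sym (trans (lookup-row row i) (proj₁ (simple Fin.zero (Fin.suc i))))
  upper⇒realises (x ∷ xs) simple (_ , rest) (Fin.suc i) (Fin.suc j) =
    upper⇒realises xs (λ i j → simple (Fin.suc i) (Fin.suc j)) rest i j

  induced-by : ∀ {m} (H : Pattern m) {_ : True (simpleGraph? H)} {_ : True (twinFree? H)} →
               (xs : Vec (Vertex G) m) → UpperTriangle xs H → InducedIn H G
  induced-by H {simple} {twin-free} xs upper =
    realises⇒induced (toWitness twin-free)
                     (upper⇒realises xs (toWitness simple) upper)

  hole-realises-cycle : (C : Hole G) → Realises (Cycle-E (len C)) (v C)
  hole-realises-cycle C i j =
    does-⇔ (⇔.trans Bool.T-≡ (v-adj C i j)) (T? (E G (v C i) (v C j))) (cycAdj? (len C) i j)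

  cycle₅⇒C5 : ∀ {k} (f : Fin k → Vertex G) → Realises (Cycle-E k) f → k ≡ 5 → InducedIn C5-E G
  cycle₅⇒C5 f realises refl =
    realises⇒induced (from-yes (twinFree? C5-E)) λ i j → trans (realises i j) (C5-is-cycle i j)
    where
    C5-is-cycle : ∀ i j → Cycle-E 5 i j ≡ C5-E i j
    C5-is-cycle = from-yes (all? λ i → all? λ j → Cycle-E 5 i j Bool.≟ C5-E i j)

module InducedPaths (G : Graph) where

  open Patterns G

  IsInducedPath : ∀ {k} → (Fin k → Vertex G) → Set
  IsInducedPath p = Injective _≡_ _≡_ p × (∀ i j → Adj G (p i) (p j) ⇔ PathAdj i j)

  path-with-apex⇒hole : ∀ {L} (p : Fin (suc L) → Vertex G) (u : Vertex G) → 2 ≤ L →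
                        IsInducedPath p → (∀ i → u ≢ p i) →
                        (∀ i → Adj G u (p i) ⇔ (toℕ i ≡ 0 ⊎ toℕ i ≡ L)) →
                        Σ (Hole G) λ H → len H ≡ 2 + L
  path-with-apex⇒hole {L} p u 2≤L (p-inj , p-adj) u∉p u-adj =
    record { len = 2 + L ; len≥4 = s≤s (s≤s 2≤L) ; v = w ; v-inj = w-inj ; v-adj = w-adj } , refl
    where
    w : Fin (2 + L) → Vertex G
    w Fin.zero    = u
    w (Fin.suc i) = p i

    w-inj : Injective _≡_ _≡_ w
    w-inj {Fin.zero}  {Fin.zero}  _ = refl
    w-inj {Fin.zero}  {Fin.suc j} e = ⊥-elim (u∉p j e)
    w-inj {Fin.suc i} {Fin.zero}  e = ⊥-elim (u∉p i (sym e))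
    w-inj {Fin.suc i} {Fin.suc j} e = cong Fin.suc (p-inj e)

    apex-cyc : ∀ j → (toℕ j ≡ 0 ⊎ toℕ j ≡ L) ⇔ CycAdj (2 + L) Fin.zero (Fin.suc j)
    apex-cyc j = mk⇔ to from
      where
      to : _ → _
      to (inj₁ j≡0) = inj₁ (cong suc (sym j≡0))
      to (inj₂ j≡L) = inj₂ (inj₂ (inj₁ (refl , cong (suc ∘ suc) j≡L)))
      from : _ → _
      from (inj₁ 1≡1+j)                  = inj₁ (sym (suc-injective 1≡1+j))
      from (inj₂ (inj₂ (inj₁ (_ , e)))) = inj₂ (suc-injective (suc-injective e))

    path-cyc : ∀ i j → PathAdj i j ⇔ CycAdj (2 + L) (Fin.suc i) (Fin.suc j)
    path-cyc i j = mk⇔ to from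
      where
      to : _ → _
      to (inj₁ e) = inj₁ (cong suc e)
      to (inj₂ e) = inj₂ (inj₁ (cong suc e))
      from : _ → _
      from (inj₁ e)        = inj₁ (suc-injective e)
      from (inj₂ (inj₁ e)) = inj₂ (suc-injective e)
      from (inj₂ (inj₂ (inj₁ (() , _))))
      from (inj₂ (inj₂ (inj₂ (() , _))))

    w-adj : ∀ i j → Adj G (w i) (w j) ⇔ CycAdj (2 + L) i j
    w-adj Fin.zero Fin.zero =
      mk⇔ (⊥-elim ∘ adj-irrefl)
          λ { (inj₁ ()) ; (inj₂ (inj₁ ())) ; (inj₂ (inj₂ (inj₁ (_ , ())))) ; (inj₂ (inj₂ (inj₂ (_ , ())))) }
    w-adj Fin.zero (Fin.suc j) = ⇔.trans (u-adj j) (apex-cyc j)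
    w-adj (Fin.suc i) Fin.zero =
      ⇔.trans (mk⇔ E-sym E-sym) (⇔.trans (u-adj i) (⇔.trans (apex-cyc i) (mk⇔ cycAdj-sym cycAdj-sym)))
    w-adj (Fin.suc i) (Fin.suc j) = ⇔.trans (p-adj i j) (path-cyc i j)

-- Positions on a hole

module HolePositions {G : Graph} (C : Hole G) where

  open Patterns G
  open InducedPaths G

  K : ℕ
  K = len C

  1<K : 1 < K
  1<K = ≤-trans (s≤s (s≤s z≤n)) (len≥4 C)

  instance
    K≢0 : NonZero K
    K≢0 = >-nonZero (<-trans (s≤s z≤n) 1<K)

  c : ℕ → Vertex G
  c x = v C (x mod K)

  toℕ-mod : ∀ x → toℕ (x mod K) ≡ x % K
  toℕ-mod x = toℕ-fromℕ< (m%n<n x K)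

  c-cong : ∀ {x y} → x % K ≡ y % K → c x ≡ c y
  c-cong {x} {y} eq = cong (v C) (toℕ-injective (trans (toℕ-mod x) (trans eq (sym (toℕ-mod y)))))

  c-injective : ∀ {x y} → c x ≡ c y → x % K ≡ y % K
  c-injective {x} {y} eq = trans (sym (toℕ-mod x)) (trans (cong toℕ (v-inj C eq)) (toℕ-mod y))

  c-+K : ∀ x → c (K + x) ≡ c x
  c-+K x = c-cong (trans (cong (_% K) (+-comm K x)) ([m+n]%n≡m%n x K))

  v≡c : ∀ j → v C j ≡ c (toℕ j)
  v≡c j = cong (v C) (toℕ-injective (sym (trans (toℕ-mod (toℕ j)) (m<n⇒m%n≡m (toℕ<n j)))))

  suc-% : ∀ x → suc x % K ≡ suc (x % K) % K
  suc-% x = trans (%-distribˡ-+ 1 x K) (cong (λ e → (e + x % K) % K) (m<n⇒m%n≡m 1<K))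

  c-adj-suc : ∀ x → Adj G (c x) (c (suc x))
  c-adj-suc x = Equivalence.from (v-adj C _ _) cyc
    where
    r = x % K
    cyc : CycAdj K (x mod K) (suc x mod K)
    cyc with suc r <? K
    ... | yes 1+r<K = inj₁ (trans (cong suc (toℕ-mod x))
                        (sym (trans (toℕ-mod (suc x)) (trans (suc-% x) (m<n⇒m%n≡m 1+r<K)))))
    ... | no  1+r≮K = inj₂ (inj₂ (inj₂ (wraps-to-0 , trans (cong suc (toℕ-mod x)) 1+r≡K)))
      where
      1+r≡K : suc r ≡ K
      1+r≡K = ≤-antisym (m%n<n x K) (≮⇒≥ 1+r≮K)
      wraps-to-0 : toℕ (suc x mod K) ≡ 0
      wraps-to-0 = trans (toℕ-mod (suc x)) (trans (suc-% x) (trans (cong (_% K) 1+r≡K) (n%n≡0 K)))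

  adj⇒consecutive : ∀ {x y} → Adj G (c x) (c y) → suc x % K ≡ y % K ⊎ suc y % K ≡ x % K
  adj⇒consecutive {x} {y} x~y = case Equivalence.to (v-adj C _ _) x~y of λ where
      (inj₁ e)                        → inj₁ (step x y e)
      (inj₂ (inj₁ e))                 → inj₂ (step y x e)
      (inj₂ (inj₂ (inj₁ (x≡0 , e)))) → inj₂ (wrap y x x≡0 e)
      (inj₂ (inj₂ (inj₂ (y≡0 , e)))) → inj₁ (wrap x y y≡0 e)
    where
    via-% : ∀ x y → suc (x % K) % K ≡ y % K → suc x % K ≡ y % K
    via-% x y = trans (suc-% x)
    step : ∀ x y → suc (toℕ (x mod K)) ≡ toℕ (y mod K) → suc x % K ≡ y % K
    step x y e rewrite toℕ-mod x | toℕ-mod y =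
      via-% x y (trans (cong (_% K) e) (m%n%n≡m%n y K))
    wrap : ∀ x y → toℕ (y mod K) ≡ 0 → suc (toℕ (x mod K)) ≡ K → suc x % K ≡ y % K
    wrap x y y≡0 e rewrite toℕ-mod x | toℕ-mod y =
      via-% x y (trans (cong (_% K) e) (trans (n%n≡0 K) (sym y≡0)))

  c-adj-offset : ∀ x {d} → d + 2 ≤ K → Adj G (c x) (c (d + x)) ⇔ d ≡ 1
  c-adj-offset x {d} d+2≤K = mk⇔ to from
    where
    1+d<K : suc d < K
    1+d<K = subst (_≤ K) (+-comm d 2) d+2≤K
    to : Adj G (c x) (c (d + x)) → d ≡ 1
    to adj with adj⇒consecutive adj
    ... | inj₁ e = sym (%-window-injective x 1<K (<-trans (n<1+n d) 1+d<K) e)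
    ... | inj₂ e = case %-window-injective x 1+d<K (<-trans (s≤s z≤n) 1<K) e of λ ()
    from : d ≡ 1 → Adj G (c x) (c (d + x))
    from refl = c-adj-suc x

  segment-adj : ∀ a {i j} → i < j → j + 2 ≤ i + K → Adj G (c (i + a)) (c (j + a)) ⇔ suc i ≡ j
  segment-adj a {i} i<j j+2≤i+K with m≤n⇒∃[o]m+o≡n (<⇒≤ i<j)
  ... | d , refl rewrite +-comm i d | +-assoc d i a =
    ⇔.trans (c-adj-offset (i + a) d+2≤K) (mk⇔ (λ { refl → refl }) (λ e → +-cancelʳ-≡ i d 1 (sym e)))
    where
    d+2≤K : d + 2 ≤ K
    d+2≤K = +-cancelˡ-≤ i (d + 2) K (subst (_≤ i + K) (regroup d i) j+2≤i+K)
      where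
      regroup : ∀ d i → (d + i) + 2 ≡ i + (d + 2)
      regroup = solve-∀

  segment-is-path : ∀ a {L} → L + 2 ≤ K → IsInducedPath (λ (i : Fin (suc L)) → c (toℕ i + a))
  segment-is-path a {L} L+2≤K = injective , adjacency
    where
    index<K : ∀ (i : Fin (suc L)) → toℕ i < K
    index<K i = ≤-trans (toℕ<n i) (≤-trans (m≤m+n (suc L) 1) (subst (_≤ K) (+-suc L 1) L+2≤K))
    bound : ∀ i (j : Fin (suc L)) → toℕ j + 2 ≤ i + K
    bound i j = ≤-trans (+-monoˡ-≤ 2 (s≤s⁻¹ (toℕ<n j))) (≤-trans L+2≤K (m≤n+m K i))
    not-backwards : ∀ {i j} → i < j → suc j ≢ i
    not-backwards i<j 1+j≡i = <-asym i<j (subst (_ <_) 1+j≡i (n<1+n _))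
    injective : Injective _≡_ _≡_ (λ (i : Fin (suc L)) → c (toℕ i + a))
    injective {i} {j} eq = toℕ-injective (%-window-injective a (index<K i) (index<K j) (c-injective eq))
    adjacency : ∀ i j → Adj G (c (toℕ i + a)) (c (toℕ j + a)) ⇔ PathAdj i j
    adjacency i j with <-cmp (toℕ i) (toℕ j)
    ... | tri< i<j _ _ = ⇔.trans (segment-adj a i<j (bound (toℕ i) j))
                                 (mk⇔ inj₁ [ id , ⊥-elim ∘ not-backwards i<j ]′)
    ... | tri> _ _ j<i = ⇔.trans (mk⇔ E-sym E-sym) (⇔.trans (segment-adj a j<i (bound (toℕ j) i))
                                 (mk⇔ inj₂ [ ⊥-elim ∘ not-backwards j<i , id ]′))
    ... | tri≈ _ i≡j _ =
      mk⇔ (λ adj → ⊥-elim (adj-irrefl (subst (λ k → Adj G (c (toℕ i + a)) (c (k + a))) (sym i≡j) adj)))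
          [ (λ e → ⊥-elim (1+n≢n (trans e (sym i≡j)))) , (λ e → ⊥-elim (1+n≢n (trans e i≡j))) ]′

  gap-hole : (u : Vertex G) → (∀ i → u ≢ v C i) → ∀ a L → 2 ≤ L → L + 2 ≤ K →
             Adj G u (c a) → Adj G u (c (L + a)) → (∀ x → 0 < x → x < L → E G u (c (x + a)) ≡ false) →
             Σ (Hole G) λ H → len H ≡ 2 + L
  gap-hole u u∉C a L 2≤L L+2≤K u~a u~L+a gap =
    path-with-apex⇒hole (λ i → c (toℕ i + a)) u 2≤L (segment-is-path a L+2≤K) (λ _ → u∉C _) u-adj
    where
    u-adj : ∀ (i : Fin (suc L)) → Adj G u (c (toℕ i + a)) ⇔ (toℕ i ≡ 0 ⊎ toℕ i ≡ L)
    u-adj i = mk⇔ to [ (λ i≡0 → subst (λ k → Adj G u (c (k + a))) (sym i≡0) u~a)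
                     , (λ i≡L → subst (λ k → Adj G u (c (k + a))) (sym i≡L) u~L+a) ]′
      where
      to : Adj G u (c (toℕ i + a)) → toℕ i ≡ 0 ⊎ toℕ i ≡ L
      to adj with toℕ i ≟ 0 | toℕ i ≟ L
      ... | yes i≡0 | _       = inj₁ i≡0
      ... | no _    | yes i≡L = inj₂ i≡L
      ... | no i≢0  | no i≢L  =
        ⊥-elim (Bool.not-¬ adj (gap (toℕ i) (n≢0⇒n>0 i≢0) (≤∧≢⇒< (s≤s⁻¹ (toℕ<n i)) i≢L)))

  offset : ∀ w (j : Fin K) → ∃[ d ] d < K × c (d + w) ≡ v C j
  offset w j = d , m%n<n _ K , trans (c-cong (begin
      (d + w) % K                        ≡⟨ %-distribˡ-+ d w K ⟩
      (d % K + r) % K                    ≡⟨ cong (λ e → (e + r) % K) (m%n%n≡m%n (toℕ j + (K ∸ r)) K) ⟩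
      (d + r) % K                        ≡⟨ cong (λ e → (d + e) % K) (m%n%n≡m%n w K) ⟨
      (d + r % K) % K                    ≡⟨ %-distribˡ-+ (toℕ j + (K ∸ r)) r K ⟨
      (toℕ j + (K ∸ r) + r) % K          ≡⟨ cong (_% K) (+-assoc (toℕ j) (K ∸ r) r) ⟩
      (toℕ j + (K ∸ r + r)) % K          ≡⟨ cong (λ e → (toℕ j + e) % K) (m∸n+n≡m (m%n≤n w K)) ⟩
      (toℕ j + K) % K                    ≡⟨ [m+n]%n≡m%n (toℕ j) K ⟩
      toℕ j % K                          ∎)) (sym (v≡c j))
    where
    open ≡-Reasoning
    r = w % K
    d = (toℕ j + (K ∸ r)) % K

  c-offset-mod : ∀ d w → c (d + w % K) ≡ c (d + w)
  c-offset-mod d w = c-cong (trans (%-distribˡ-+ d (w % K) K)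
                       (trans (cong (λ r → (d % K + r) % K) (m%n%n≡m%n w K)) (sym (%-distribˡ-+ d w K))))

-- A vertex off a shortest odd hole

odd-≢5⇒≥7 : ∀ k → Odd (4 + k) → 4 + k ≢ 5 → 7 ≤ 4 + k
odd-≢5⇒≥7 0 odd _ = ⊥-elim (even⇒¬odd (2 , refl) odd)
odd-≢5⇒≥7 1 _ ≢5  = ⊥-elim (≢5 refl)
odd-≢5⇒≥7 2 odd _ = ⊥-elim (even⇒¬odd (3 , refl) odd)
odd-≢5⇒≥7 (suc (suc (suc k))) _ _ = m≤m+n 7 k

module ShortestOddHoleIsClean
  (G : Graph) (no-C5 : ¬ InducedIn C5-E G) (no-bull : ¬ InducedIn Bull-E G)
  (no-anchor₁ : ¬ InducedIn Anchor1-E G) (no-anchor₂ : ¬ InducedIn Anchor2-E G)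
  (C : Hole G) (shortest : ShortestOddHole G C) where

  open Patterns G
  open HolePositions C

  7≤K : 7 ≤ K
  7≤K with m≤n⇒∃[o]m+o≡n (len≥4 C)
  ... | k , 4+k≡K = subst (7 ≤_) 4+k≡K (odd-≢5⇒≥7 k (subst Odd (sym 4+k≡K) (proj₁ shortest)) not-C5)
    where
    not-C5 : 4 + k ≢ 5
    not-C5 4+k≡5 = no-C5 (cycle₅⇒C5 (v C) (hole-realises-cycle C) (trans (sym 4+k≡K) 4+k≡5))

  hole-edge : ∀ b i j {_ : True (i <? j)} {_ : True (j ≤? 5)} →
              E G (c (i + b)) (c (j + b)) ≡ does (suc i ≟ j)
  hole-edge b i j {i<j} {j≤5} =
    does-⇔ (⇔.trans Bool.T-≡ (segment-adj b (toWitness i<j) bound)) (T? _) (suc i ≟ j)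
    where
    bound : j + 2 ≤ i + K
    bound = ≤-trans (+-monoˡ-≤ 2 (toWitness j≤5)) (≤-trans 7≤K (m≤n+m K i))

  hole-non-edge : ∀ b {i j} → 2 + i ≤ j → j + 2 ≤ i + K → E G (c (i + b)) (c (j + b)) ≡ false
  hole-non-edge b {i} 2+i≤j bound = Bool.¬-not λ adj →
    1+n≰n (subst (2 + i ≤_) (sym (Equivalence.to (segment-adj b (<-trans (n<1+n i) 2+i≤j) bound) adj)) 2+i≤j)

  module Neighbours (u : Vertex G) (u∉C : ∀ i → u ≢ v C i) where

    Nbr : ℕ → Set
    Nbr x = Adj G u (c x)

    NonNbr : ℕ → Set
    NonNbr x = E G u (c x) ≡ false

    nbr⊎nonNbr : ∀ x → Nbr x ⊎ NonNbr x
    nbr⊎nonNbr x with E G u (c x)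
    ... | true  = inj₁ refl
    ... | false = inj₂ refl

    Window : ℕ → Set
    Window w = ∀ d → d < K → Nbr (d + w) → d ≤ 2

    window⇒clean : ∀ {w} → Window w → ∃[ i ] ∀ j → Adj G u (v C j) → j ≡ i ⊎ CycAdj K i j
    window⇒clean {w} window = suc w mod K , λ j u~j →
      let d , d<K , c[d+w]≡j = offset w j in
      near d (window d d<K (subst (Adj G u) (sym c[d+w]≡j) u~j)) (v-inj C c[d+w]≡j)
      where
      near : ∀ {j} d → d ≤ 2 → (d + w) mod K ≡ j → j ≡ suc w mod K ⊎ CycAdj K (suc w mod K) j
      near 0 _ refl = inj₂ (Equivalence.to (v-adj C _ _) (E-sym (c-adj-suc w)))
      near 1 _ refl = inj₁ refl
      near 2 _ refl = inj₂ (Equivalence.to (v-adj C _ _) (c-adj-suc (suc w)))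
      near (suc (suc (suc _))) (s≤s (s≤s ())) _

    isolated-pair-impossible : ∀ b → NonNbr b → Nbr (1 + b) → Nbr (2 + b) → NonNbr (3 + b) → ⊥
    isolated-pair-impossible b m0 n1 n2 m3 = no-bull (induced-by Bull-E
      (c (1 + b) ∷ c (2 + b) ∷ u ∷ c b ∷ c (3 + b) ∷ [])
      ( (hole-edge b 1 2 , E-sym n1 , E-sym (hole-edge b 0 1) , hole-edge b 1 3 , _)
      , (E-sym n2 , E-sym (hole-edge b 0 2) , hole-edge b 2 3 , _)
      , (m0 , m3 , _)
      , (hole-edge b 0 3 , _) , _ , _))

    four-run-impossible : ∀ b → Nbr b → Nbr (1 + b) → Nbr (2 + b) → Nbr (3 + b) → ⊥
    four-run-impossible b n0 n1 n2 n3 with nbr⊎nonNbr (5 + b)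
    ... | inj₁ n5 = no-anchor₂ (induced-by Anchor2-E
      (c b ∷ c (1 + b) ∷ c (2 + b) ∷ c (3 + b) ∷ u ∷ c (5 + b) ∷ [])
      ( (hole-edge b 0 1 , hole-edge b 0 2 , hole-edge b 0 3 , E-sym n0 , hole-edge b 0 5 , _)
      , (hole-edge b 1 2 , hole-edge b 1 3 , E-sym n1 , hole-edge b 1 5 , _)
      , (hole-edge b 2 3 , E-sym n2 , hole-edge b 2 5 , _)
      , (E-sym n3 , hole-edge b 3 5 , _)
      , (n5 , _) , _ , _))
    ... | inj₂ m5 = no-anchor₁ (induced-by Anchor1-E
      (c b ∷ c (1 + b) ∷ c (2 + b) ∷ c (3 + b) ∷ u ∷ c (5 + b) ∷ [])
      ( (hole-edge b 0 1 , hole-edge b 0 2 , hole-edge b 0 3 , E-sym n0 , hole-edge b 0 5 , _)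
      , (hole-edge b 1 2 , hole-edge b 1 3 , E-sym n1 , hole-edge b 1 5 , _)
      , (hole-edge b 2 3 , E-sym n2 , hole-edge b 2 5 , _)
      , (E-sym n3 , hole-edge b 3 5 , _)
      , (m5 , _) , _ , _))

    beyond-three-run : ∀ b → NonNbr b → Nbr (1 + b) → Nbr (2 + b) → Nbr (3 + b) → NonNbr (4 + b) →
                       ∀ j → 4 ≤ j → j ≤ K → ¬ Nbr (j + b)
    beyond-three-run b m0 n1 n2 n3 m4 j 4≤j j≤K nj with m≤n⇒m<n∨m≡n 4≤j
    ... | inj₂ refl = Bool.not-¬ nj m4
    ... | inj₁ 5≤j with m≤n⇒m<n∨m≡n 5≤j
    ...   | inj₂ refl = no-bull (induced-by Bull-E
      (c (1 + b) ∷ u ∷ c (2 + b) ∷ c b ∷ c (5 + b) ∷ [])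
      ( (E-sym n1 , hole-edge b 1 2 , E-sym (hole-edge b 0 1) , hole-edge b 1 5 , _)
      , (n2 , m0 , nj , _)
      , (E-sym (hole-edge b 0 2) , hole-edge b 2 5 , _)
      , (hole-edge b 0 5 , _) , _ , _))
    ...   | inj₁ 6≤j = no-bull (induced-by Bull-E
      (c (3 + b) ∷ u ∷ c (2 + b) ∷ c (4 + b) ∷ c (j + b) ∷ [])
      ( (E-sym n3 , E-sym (hole-edge b 2 3) , hole-edge b 3 4 , far 3 , _)
      , (n2 , m4 , nj , _)
      , (hole-edge b 2 4 , far 2 , _)
      , (far 4 , _) , _ , _))
      where
      far : ∀ i {_ : True (2 ≤? i)} {_ : True (i ≤? 4)} → E G (c (i + b)) (c (j + b)) ≡ false
      far i {2≤i} {i≤4} =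
        hole-non-edge b (≤-trans (+-monoʳ-≤ 2 (toWitness i≤4)) 6≤j)
          (≤-trans (+-monoˡ-≤ 2 j≤K) (subst (_≤ i + K) (+-comm 2 K) (+-monoˡ-≤ K (toWitness 2≤i))))

    three-run⇒window : ∀ b → NonNbr b → Nbr (1 + b) → Nbr (2 + b) → Nbr (3 + b) → NonNbr (4 + b) →
                       Window (1 + b)
    three-run⇒window b m0 n1 n2 n3 m4 d d<K nd with d ≤? 2
    ... | yes d≤2 = d≤2
    ... | no  d≰2 =
      ⊥-elim (beyond-three-run b m0 n1 n2 n3 m4 (suc d) (s≤s (≰⇒> d≰2)) d<K (subst Nbr (+-suc d b) nd))

    -- q is t − 2 modulo K, so the given neighbours sit at 2 + q and 3 + q; the cases follow the
    -- maximal run of neighbours containing them.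
    consecutive⇒window : ∀ t → Nbr t → Nbr (1 + t) → ∃ Window
    consecutive⇒window t nt nt+1 with m≤n⇒∃[o]m+o≡n 7≤K
    ... | m , 7+m≡K = runs (nbr⊎nonNbr q) (nbr⊎nonNbr (1 + q)) (nbr⊎nonNbr (4 + q)) (nbr⊎nonNbr (5 + q))
      where
      q = 5 + m + t
      2+q≡K+t : 2 + q ≡ K + t
      2+q≡K+t = cong (_+ t) 7+m≡K
      n2 : Nbr (2 + q)
      n2 = subst (Adj G u) (sym (trans (cong c 2+q≡K+t) (c-+K t))) nt
      n3 : Nbr (3 + q)
      n3 = subst (Adj G u) (sym (trans (cong c (trans (cong suc 2+q≡K+t) (sym (+-suc K t)))) (c-+K (suc t)))) nt+1
      runs : _ → _ → _ → _ → ∃ Window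
      runs _         _         (inj₁ n4) (inj₁ n5) = ⊥-elim (four-run-impossible (2 + q) n2 n3 n4 n5)
      runs _         (inj₁ n1) (inj₁ n4) (inj₂ _)  = ⊥-elim (four-run-impossible (1 + q) n1 n2 n3 n4)
      runs _         (inj₂ m1) (inj₁ n4) (inj₂ m5) = 2 + q , three-run⇒window (1 + q) m1 n2 n3 n4 m5
      runs _         (inj₂ m1) (inj₂ m4) _         = ⊥-elim (isolated-pair-impossible (1 + q) m1 n2 n3 m4)
      runs (inj₁ n0) (inj₁ n1) (inj₂ _)  _         = ⊥-elim (four-run-impossible q n0 n1 n2 n3)
      runs (inj₂ m0) (inj₁ n1) (inj₂ m4) _         = 1 + q , three-run⇒window q m0 n1 n2 n3 m4

    window? : ∀ w → Dec (Window w)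
    window? w = map′ to from (all? λ (d : Fin K) → (E G u (c (toℕ d + w)) Bool.≟ true) →-dec (toℕ d ≤? 2))
      where
      to : (∀ (d : Fin K) → Nbr (toℕ d + w) → toℕ d ≤ 2) → Window w
      to all-d d d<K = subst (λ e → Nbr (e + w) → e ≤ 2) (toℕ-fromℕ< d<K) (all-d (fromℕ< d<K))
      from : Window w → ∀ (d : Fin K) → Nbr (toℕ d + w) → toℕ d ≤ 2
      from window d = window (toℕ d) (toℕ<n d)

    window-after-long-gap : ∀ a L → K ≤ L + 2 → (∀ x → 0 < x → x < L → NonNbr (x + a)) →
                            Window (L + a)
    window-after-long-gap a L K≤L+2 gap e e<K ne with e ≤? 2
    ... | yes e≤2 = e≤2
    ... | no  e≰2 = ⊥-elim (wraps-into-gap (≤-trans (s≤s K≤L+2) L+3≤e+L))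
      where
      L+3≤e+L : suc (L + 2) ≤ e + L
      L+3≤e+L = subst (_≤ e + L) (trans (+-comm 3 L) (+-suc L 2)) (+-monoˡ-≤ L (≰⇒> e≰2))
      wraps-into-gap : K < e + L → ⊥
      wraps-into-gap K<e+L with m≤n⇒∃[o]m+o≡n (<⇒≤ K<e+L)
      ... | x , K+x≡e+L = Bool.not-¬ (subst (Adj G u) same-vertex ne) (gap x 0<x x<L)
        where
        0<x : 0 < x
        0<x = +-cancelˡ-< K 0 x (subst₂ _<_ (sym (+-identityʳ K)) (sym K+x≡e+L) K<e+L)
        x<L : x < L
        x<L = +-cancelˡ-< K x L (subst (_< K + L) (sym K+x≡e+L) (+-monoˡ-< L e<K))
        same-vertex : c (e + (L + a)) ≡ c (x + a)
        same-vertex = trans (cong c (begin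
          e + (L + a) ≡⟨ +-assoc e L a ⟨
          e + L + a   ≡⟨ cong (_+ a) K+x≡e+L ⟨
          K + x + a   ≡⟨ +-assoc K x a ⟩
          K + (x + a) ∎)) (c-+K (x + a))
          where open ≡-Reasoning

    module WithoutWindow (no-window : ∀ w → ¬ Window w) where

      gap-even : ∀ a L → Nbr a → Nbr (L + a) → 0 < L → L ≤ K →
                 (∀ x → 0 < x → x < L → NonNbr (x + a)) → Even L
      gap-even a L na nL 0<L L≤K gap with m≤n⇒m<n∨m≡n 0<L
      ... | inj₂ refl = ⊥-elim (no-window _ (proj₂ (consecutive⇒window a na nL)))
      ... | inj₁ 2≤L with 2 + L <? K
      ...   | no  2+L≮K =
        ⊥-elim (no-window (L + a) (window-after-long-gap a L (subst (K ≤_) (+-comm 2 L) (≮⇒≥ 2+L≮K)) gap))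
      ...   | yes 2+L<K with gap-hole u u∉C a L 2≤L (subst (_≤ K) (+-comm 2 L) (<⇒≤ 2+L<K)) na nL gap
      ...     | H , len≡2+L = [ id , (λ odd → ⊥-elim (<⇒≱ 2+L<K (K≤2+L odd))) ]′ (even⊎odd L)
        where
        K≤2+L : Odd L → K ≤ 2 + L
        K≤2+L odd = subst (K ≤_) len≡2+L (proj₂ shortest H (subst Odd (sym len≡2+L) (odd-2+ odd)))

      module FromNeighbour (p : ℕ) (np : Nbr p) where

        record LastNbr (d : ℕ) : Set where
          field
            ℓ     : ℕ
            ℓ≤d   : ℓ ≤ d
            nbr   : Nbr (ℓ + p)
            even  : Even ℓ
            after : ∀ x → ℓ < x → x ≤ d → NonNbr (x + p)

        next-even : ∀ {d} → LastNbr d → suc d ≤ K → Nbr (suc d + p) → Even (suc d)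
        next-even {d} last 1+d≤K n with m≤n⇒∃[o]m+o≡n (m≤n⇒m≤1+n (LastNbr.ℓ≤d last))
        ... | L , ℓ+L≡1+d = subst Even ℓ+L≡1+d (even-+ even (gap-even (ℓ + p) L nbr nL 0<L L≤K gap))
          where
          open LastNbr last
          regroup : ∀ ℓ L p → (ℓ + L) + p ≡ L + (ℓ + p)
          regroup = solve-∀
          nL : Nbr (L + (ℓ + p))
          nL = subst Nbr (trans (cong (_+ p) (sym ℓ+L≡1+d)) (regroup ℓ L p)) n
          0<L : 0 < L
          0<L = n≢0⇒n>0 λ { refl → 1+n≰n (subst (_≤ d) (trans (sym (+-identityʳ ℓ)) ℓ+L≡1+d) ℓ≤d) }
          L≤K : L ≤ K
          L≤K = ≤-trans (m≤n+m L ℓ) (subst (_≤ K) (sym ℓ+L≡1+d) 1+d≤K)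
          gap : ∀ x → 0 < x → x < L → NonNbr (x + (ℓ + p))
          gap x 0<x x<L = subst NonNbr (regroup ℓ x p)
            (after (ℓ + x) (subst (_< ℓ + x) (+-identityʳ ℓ) (+-monoʳ-< ℓ 0<x))
                   (s≤s⁻¹ (subst (suc (ℓ + x) ≤_) ℓ+L≡1+d (+-monoʳ-< ℓ x<L))))

        last-nbr : ∀ d → d ≤ K → LastNbr d
        last-nbr zero _ = record
          { ℓ = 0 ; ℓ≤d = z≤n ; nbr = np ; even = 0 , refl ; after = λ x 0<x x≤0 → ⊥-elim (<⇒≱ 0<x x≤0) }
        last-nbr (suc d) 1+d≤K with last-nbr d (<⇒≤ 1+d≤K) | nbr⊎nonNbr (suc d + p)
        ... | last | inj₁ n = record
          { ℓ = suc d ; ℓ≤d = ≤-refl ; nbr = n ; even = next-even last 1+d≤K n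
          ; after = λ x 1+d<x x≤1+d → ⊥-elim (<⇒≱ 1+d<x x≤1+d) }
        ... | last | inj₂ m = let open LastNbr last in record
          { ℓ = ℓ ; ℓ≤d = m≤n⇒m≤1+n ℓ≤d ; nbr = nbr ; even = even
          ; after = λ x ℓ<x x≤1+d → [ after x ℓ<x ∘ s≤s⁻¹ , (λ { refl → m }) ]′ (m≤n⇒m<n∨m≡n x≤1+d) }

        -- Position K + p is p again, so the last neighbour up to offset K sits at offset K, which is odd.
        impossible : ⊥
        impossible with last-nbr K ≤-refl
        ... | last with m≤n⇒m<n∨m≡n (LastNbr.ℓ≤d last)
        ...   | inj₁ ℓ<K = Bool.not-¬ (subst (Adj G u) (sym (c-+K p)) np) (LastNbr.after last K ℓ<K ≤-refl)
        ...   | inj₂ ℓ≡K = even⇒¬odd (subst Even ℓ≡K (LastNbr.even last)) (proj₁ shortest)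

      impossible : ⊥
      impossible = no-window 0 λ d _ nd → ⊥-elim (FromNeighbour.impossible (d + 0) nd)

    window-mod : ∀ w → Window w → Window (toℕ (w mod K))
    window-mod w window rewrite toℕ-mod w = λ d d<K nd → window d d<K (subst (Adj G u) (c-offset-mod d w) nd)

    window-exists : ∃ Window
    window-exists with any? (window? ∘ toℕ {K})
    ... | yes (w , window) = toℕ w , window
    ... | no  no-window    =
      ⊥-elim (WithoutWindow.impossible λ w window → no-window (w mod K , window-mod w window))

  clean : Clean G C
  clean u u∉C = Neighbours.window⇒clean u u∉C (proj₂ (Neighbours.window-exists u u∉C))

-- Searching for a shortest odd hole

cons : ∀ {m} {A : Set} → A → (Fin m → A) → Fin (suc m) → A
cons x g Fin.zero    = x
cons x g (Fin.suc i) = g i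

any-function? : ∀ {k} m (P : (Fin m → Fin k) → Set) → (∀ f → Dec (P f)) →
                (∀ f g → f ≗ g → P f → P g) → Dec (∃ P)
any-function? zero P P? P-resp with P? (λ ())
... | yes p = yes (_ , p)
... | no ¬p = no λ (f , pf) → ¬p (P-resp f _ (λ ()) pf)
any-function? (suc m) P P? P-resp
  with any? (λ x → any-function? m (P ∘ cons x) (P? ∘ cons x)
                     (λ f g f≗g → P-resp _ _ λ { Fin.zero → refl ; (Fin.suc i) → f≗g i }))
... | yes (x , g , p) = yes (cons x g , p)
... | no ¬p = no λ (f , pf) → ¬p (f Fin.zero , f ∘ Fin.suc ,
                                  P-resp f _ (λ { Fin.zero → refl ; (Fin.suc i) → refl }) pf)

least-or-none : {P : ℕ → Set} → (∀ L → Dec (P L)) → ∀ B →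
                (∀ L → L < B → ¬ P L) ⊎ ∃[ L ] (P L × ∀ L′ → L′ < L → ¬ P L′)
least-or-none P? zero = inj₁ λ _ ()
least-or-none P? (suc B) with least-or-none P? B
... | inj₂ least = inj₂ least
... | inj₁ none-below with P? B
...   | yes p = inj₂ (B , p , none-below)
...   | no ¬p = inj₁ λ L L<1+B → [ none-below L , (λ { refl → ¬p }) ]′ (m≤n⇒m<n∨m≡n (s≤s⁻¹ L<1+B))

dec-⇔ : ∀ {A B : Set} → Dec A → Dec B → Dec (A ⇔ B)
dec-⇔ A? B? = map′ (λ (to , from) → mk⇔ to from) (λ A⇔B → Equivalence.to A⇔B , Equivalence.from A⇔B)
                   ((A? →-dec B?) ×-dec (B? →-dec A?))

module _ (G : Graph) where

  IsHole : ∀ L → (Fin L → Vertex G) → Set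
  IsHole L f = 4 ≤ L × (∀ i j → f i ≡ f j → i ≡ j) × (∀ i j → Adj G (f i) (f j) ⇔ CycAdj L i j)

  isHole? : ∀ L f → Dec (IsHole L f)
  isHole? L f = (4 ≤? L) ×-dec all? (λ i → all? λ j → (f i ≟ᶠ f j) →-dec (i ≟ᶠ j))
                         ×-dec all? (λ i → all? λ j → dec-⇔ (E G (f i) (f j) Bool.≟ true) (cycAdj? L i j))

  OddHoleOfLength : ℕ → Set
  OddHoleOfLength L = Odd L × Σ (Hole G) (λ C → len C ≡ L)

  oddHoleOfLength? : ∀ L → Dec (OddHoleOfLength L)
  oddHoleOfLength? L with odd? L | any-function? L (IsHole L) (isHole? L) respects
    where
    respects : ∀ f g → f ≗ g → IsHole L f → IsHole L g
    respects f g f≗g (4≤L , inj , adj) =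
      4≤L , (λ i j gi≡gj → inj i j (trans (f≗g i) (trans gi≡gj (sym (f≗g j))))) ,
      (λ i j → subst₂ (λ x y → Adj G x y ⇔ CycAdj L i j) (f≗g i) (f≗g j) (adj i j))
  ... | no ¬odd | _ = no (¬odd ∘ proj₁)
  ... | yes odd | yes (f , 4≤L , inj , adj) =
    yes (odd , record { len = L ; len≥4 = 4≤L ; v = f ; v-inj = inj _ _ ; v-adj = adj } , refl)
  ... | yes odd | no ¬hole = no λ { (_ , C , refl) → ¬hole (v C , len≥4 C , (λ _ _ → v-inj C) , v-adj C) }

  hole-length-≤ : (C : Hole G) → len C ≤ n G
  hole-length-≤ C = injective⇒≤ (v-inj C)

  pure-if-clean : (∀ C → ShortestOddHole G C → Clean G C) → Pure G
  pure-if-clean clean with least-or-none oddHoleOfLength? (suc (n G))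
  ... | inj₁ none = inj₁ λ (C , odd) → none (len C) (s≤s (hole-length-≤ C)) (odd , C , refl)
  ... | inj₂ (L , (odd , C , refl) , least) = inj₂ (C , shortest , clean C shortest)
    where
    shortest : ShortestOddHole G C
    shortest = odd , λ D odd-D → ≮⇒≥ λ D<C → least (len D) D<C (odd-D , D , refl)

theorem2p1 : (G : Graph) →
    ¬ InducedIn C5-E G → ¬ InducedIn Bull-E G →
    ¬ InducedIn Anchor1-E G → ¬ InducedIn Anchor2-E G →
    Pure G × (∀ (C : Hole G) → ShortestOddHole G C → Clean G C)
theorem2p1 G no-C5 no-bull no-anchor₁ no-anchor₂ = pure-if-clean G clean , clean
  where
  clean : ∀ C → ShortestOddHole G C → Clean G C
  clean = ShortestOddHoleIsClean.clean G no-C5 no-bull no-anchor₁ no-anchor₂
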